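{- Let $y,z,x_1,\dots,x_t\in\mathcal{A}$ satisfy $y\succeq_{\mathrm{col}}x_1\succeq_{\mathrm{col}}x_2\succeq_{\mathrm{col}}\cdots\succeq_{\mathrm{col}}x_t$ and $y\le z$, and suppose that neither $y=z{\Downarrow}$ nor ($y=z$ with $y,z$ barred) holds. Then $y\,x_1x_2\cdots x_t\,z=y\,z\,x_1x_2\cdots x_t$ in $\mathcal{U}/I^{\mathrm{kron}}$.
   Context: $\mathcal{A}=\{1,\dots,N\}\sqcup\{\bar1,\dots,\bar N\}$ (unbarred/barred letters). Natural order $<$: $1<\bar1<2<\bar2<\cdots<N<\bar N$; $y\succeq_{\mathrm{col}}x$ means $y>x$ or $x,y$ are equal barred letters. $\mathcal{U}$: free associative $\mathbb{Z}$-algebra on noncommuting $u_x$ ($x\in\mathcal{A}$), monomials identified with words in $\mathcal{A}$. $a{\Downarrow}=\overline{a-1}$ for $a\in\{2,\dots,N\}$, $\bar a{\Downarrow}=a$ ($1{\Downarrow}$ undefined). $I^{\mathrm{kron}}$ is the two-sided ideal generated by: $yyx-yxy$ ($x\in\mathcal{A}$, $y$ unbarred, $x<y$); $zyy-yzy$ ($y$ unbarred, $y<z$); $yyz-yzy$ ($y$ barred, $y<z$); $xyy-yxy$ ($y$ barred, $x<y$); $(xz-zx)y-y(xz-zx)$ for $x=y{\Downarrow}=z{\Downarrow}{\Downarrow}$; $xz-zx$ for $z{\Downarrow}{\Downarrow}$ defined and $x<z{\Downarrow}{\Downarrow}$. -}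

module Defs where

open import Data.Nat as ℕ using (ℕ; zero; suc)
open import Data.Fin as Fin using (Fin; zero; suc; toℕ; inject₁)
open import Data.Bool using (Bool; true; false)
open import Data.Bool.Properties as BoolP using ()
open import Data.Fin.Properties as FinP using ()
open import Data.Integer as ℤ using (ℤ)
open import Data.List using (List; []; _∷_; _++_; map; concatMap)
open import Data.List.Properties using (≡-dec)
open import Data.Maybe using (Maybe; just; nothing)
open import Data.Product using (Σ; _×_; _,_; proj₁; proj₂)
open import Relation.Binary.PropositionalEquality using (_≡_; refl; cong₂)
open import Relation.Nullary using (Dec; yes; no; ¬_)
open import Relation.Binary.Definitions using (DecidableEquality)

-- The alphabet 𝒜 = {1..N} ⊔ {1̄..N̄}.  A letter is an index i : Fin N
-- (representing the number toℕ i + 1) together with a flag saying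
-- whether it is barred.
record Letter (N : ℕ) : Set where
  constructor ⟨_,_⟩
  field
    idx : Fin N
    bar : Bool
open Letter public

module _ {N : ℕ} where

  _≟L_ : DecidableEquality (Letter N)
  ⟨ i , b ⟩ ≟L ⟨ j , c ⟩ with i Fin.≟ j | b BoolP.≟ c
  ... | yes refl | yes refl = yes refl
  ... | no i≢j   | _        = no λ { refl → i≢j refl }
  ... | yes _    | no b≢c   = no λ { refl → b≢c refl }

  -- position in the natural order 1 < 1̄ < 2 < 2̄ < ... < N < N̄
  rank : Letter N → ℕ
  rank ⟨ i , false ⟩ = 2 ℕ.* toℕ i
  rank ⟨ i , true ⟩  = suc (2 ℕ.* toℕ i)

  _<L_ : Letter N → Letter N → Set
  x <L y = rank x ℕ.< rank y

  _≤L_ : Letter N → Letter N → Set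
  x ≤L y = rank x ℕ.≤ rank y

  Unbarred Barred : Letter N → Set
  Unbarred x = bar x ≡ false
  Barred x = bar x ≡ true

  _⪰col_ : Letter N → Letter N → Set
  y ⪰col x = (x <L y) Data.Sum.⊎ ((x ≡ y) × Barred y)
    where import Data.Sum

  down : Letter N → Maybe (Letter N)
  down ⟨ i , true ⟩        = just ⟨ i , false ⟩
  down ⟨ zero , false ⟩    = nothing
  down ⟨ suc i , false ⟩   = just ⟨ inject₁ i , true ⟩

  ColChain : Letter N → List (Letter N) → Set
  ColChain y []       = Data.Unit.⊤ where import Data.Unit
  ColChain y (x ∷ xs) = (y ⪰col x) × ColChain x xs

  Word : Set
  Word = List (Letter N)

  -- elements of the free ℤ-algebra 𝒰 as formal ℤ-linear combinations
  -- of words (equal iff all coefficients agree, see _≈P_)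
  Poly : Set
  Poly = List (ℤ × Word)

  coeff : Poly → Word → ℤ
  coeff [] w = ℤ.0ℤ
  coeff ((c , v) ∷ p) w with ≡-dec _≟L_ v w
  ... | yes _ = c ℤ.+ coeff p w
  ... | no _  = coeff p w

  _≈P_ : Poly → Poly → Set
  p ≈P q = ∀ w → coeff p w ≡ coeff q w

  mono : Word → Poly
  mono w = (ℤ.1ℤ , w) ∷ []

  _-P_ : Poly → Poly → Poly
  p -P q = p ++ map (λ { (c , w) → (ℤ.- c , w) }) q

  binom : Word → Word → Poly
  binom v w = mono v -P mono w

  comm : Letter N → Letter N → Poly
  comm x z = binom (x ∷ z ∷ []) (z ∷ x ∷ [])

  sandwich : Word → Poly → Word → Poly
  sandwich u p v = map (λ { (c , w) → (c , u ++ w ++ v) }) p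

  data KronGen : Poly → Set where
    g1 : ∀ x y → Unbarred y → x <L y →
         KronGen (binom (y ∷ y ∷ x ∷ []) (y ∷ x ∷ y ∷ []))
    g2 : ∀ y z → Unbarred y → y <L z →
         KronGen (binom (z ∷ y ∷ y ∷ []) (y ∷ z ∷ y ∷ []))
    g3 : ∀ y z → Barred y → y <L z →
         KronGen (binom (y ∷ y ∷ z ∷ []) (y ∷ z ∷ y ∷ []))
    g4 : ∀ x y → Barred y → x <L y →
         KronGen (binom (x ∷ y ∷ y ∷ []) (y ∷ x ∷ y ∷ []))
    g5 : ∀ x y z → down y ≡ just x → down z ≡ just y →
         KronGen (sandwich [] (comm x z) (y ∷ []) -P sandwich (y ∷ []) (comm x z) [])
    g6 : ∀ x z w v → down z ≡ just w → down w ≡ just v → x <L v →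
         KronGen (comm x z)

  record IdealTerm : Set where
    constructor term
    field
      c   : ℤ
      l   : Word
      g   : Poly
      gen : KronGen g
      r   : Word

  expand : IdealTerm → Poly
  expand (term c l g _ r) = map (λ { (d , w) → (c ℤ.* d , w) }) (sandwich l g r)

  InIkron : Poly → Set
  InIkron p = Σ (List IdealTerm) λ ts → p ≈P concatMap expand ts

  _≡Ikron_ : Poly → Poly → Set
  p ≡Ikron q = InIkron (p -P q)

-- Call u ≅ v when l u r − l v r ∈ I^kron for all words l, r: a congruence
-- on words containing every binomial generator. If rank z ≥ rank y + 2,
-- z commutes past every xᵢ < y by the generator xz − zx, and past the
-- leading copies xᵢ = y of a barred y by ȳȳz = ȳzȳ. The hypotheses leave
-- only the case z = y unbarred. With u = y⇓ and v = u⇓ the chain reads uᵃ,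
-- then possibly one v, then letters below v, which commute with y. The
-- generators yyu = yuy and uuy = uyu give y uᵃ y = y y uᵃ, and the generator
-- [v,y]u = u[v,y] moves the commutator [v,y] = vy − yv to the left through
-- uᵃ, where y v y = y y v kills it.
module Submission where

open import Defs
open import Data.Bool using (true; false)
open import Data.Empty using (⊥-elim)
open import Data.Fin as Fin using (toℕ)
import Data.Fin.Properties as Finₚ
open import Data.Integer using (ℤ; 0ℤ; 1ℤ; -1ℤ; _+_; _-_; _*_; -_)
import Data.Integer.Properties as ℤₚ
open import Data.Integer.Tactic.RingSolver using (solve-∀)
open import Data.List using (List; []; _∷_; _++_; map; concatMap; replicate)
open import Data.List.Properties using (≡-dec; ++-assoc; ++-identityʳ; concatMap-++)
open import Data.List.Relation.Unary.All as All using (All; []; _∷_)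
open import Data.Maybe using (just)
open import Data.Nat as ℕ using (ℕ; zero; suc; _≤_; _<_; s≤s; s≤s⁻¹; z≤n)
import Data.Nat.Properties as ℕₚ
open import Data.Product using (∃-syntax; _×_; _,_)
open import Data.Sum using (inj₁; inj₂)
open import Relation.Binary.PropositionalEquality
open import Relation.Nullary using (¬_; yes; no)

module _ {N : ℕ} where

  coeff-++ : ∀ (p q : Poly {N}) w → coeff (p ++ q) w ≡ coeff p w + coeff q w
  coeff-++ []            q w = sym (ℤₚ.+-identityˡ _)
  coeff-++ ((c , v) ∷ p) q w with ≡-dec _≟L_ v w
  ... | yes _ = trans (cong (c +_) (coeff-++ p q w)) (sym (ℤₚ.+-assoc c _ _))
  ... | no _  = coeff-++ p q w

  -- Stated for any pointwise scaling f, because the scalings inside _-P_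
  -- and expand are anonymous pattern lambdas.
  coeff-map-scale : ∀ k (f : ℤ × Word {N} → ℤ × Word {N}) →
                    (∀ c v → f (c , v) ≡ (k * c , v)) →
                    ∀ p w → coeff (map f p) w ≡ k * coeff p w
  coeff-map-scale k f f-scales [] w = sym (ℤₚ.*-zeroʳ k)
  coeff-map-scale k f f-scales ((c , v) ∷ p) w rewrite f-scales c v with ≡-dec _≟L_ v w
  ... | yes _ = trans (cong (k * c +_) (coeff-map-scale k f f-scales p w))
                      (sym (ℤₚ.*-distribˡ-+ k c _))
  ... | no _  = coeff-map-scale k f f-scales p w

  coeff-−P : ∀ (p q : Poly {N}) w → coeff (p -P q) w ≡ coeff p w - coeff q w
  coeff-−P p q w = trans (coeff-++ p _ w) (cong (coeff p w +_) coeff-negated)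
    where
    coeff-negated : coeff ([] -P q) w ≡ - coeff q w
    coeff-negated = trans (coeff-map-scale -1ℤ _ (λ c v → cong (_, v) (sym (ℤₚ.-1*i≡-i c))) q w)
                          (ℤₚ.-1*i≡-i _)

  negateTerm : IdealTerm {N} → IdealTerm {N}
  negateTerm (term c l g gen r) = term (- c) l g gen r

  coeff-expand : ∀ c l g (gen : KronGen g) r w →
                 coeff (expand (term c l g gen r)) w ≡ c * coeff (sandwich {N} l g r) w
  coeff-expand c l g gen r = coeff-map-scale c _ (λ _ _ → refl) (sandwich l g r)

  coeff-expand-negateTerm : ∀ t w → coeff (expand (negateTerm t)) w ≡ - coeff (expand t) w
  coeff-expand-negateTerm (term c l g gen r) w = begin
    coeff (expand (term (- c) l g gen r)) w ≡⟨ coeff-expand (- c) l g gen r w ⟩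
    - c * s                                 ≡⟨ ℤₚ.neg-distribˡ-* c s ⟨
    - (c * s)                               ≡⟨ cong -_ (coeff-expand c l g gen r w) ⟨
    - coeff (expand (term c l g gen r)) w   ∎
    where
    open ≡-Reasoning
    s = coeff (sandwich l g r) w

  coeff-negateTerms : ∀ ts w → coeff (concatMap expand (map negateTerm ts)) w ≡
                               - coeff (concatMap (expand {N}) ts) w
  coeff-negateTerms []       w = refl
  coeff-negateTerms (t ∷ ts) w = begin
    coeff (expand (negateTerm t) ++ concatMap expand (map negateTerm ts)) w
      ≡⟨ coeff-++ (expand (negateTerm t)) _ w ⟩
    coeff (expand (negateTerm t)) w + coeff (concatMap expand (map negateTerm ts)) w
      ≡⟨ cong₂ _+_ (coeff-expand-negateTerm t w) (coeff-negateTerms ts w) ⟩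
    - coeff (expand t) w + - coeff (concatMap expand ts) w
      ≡⟨ ℤₚ.neg-distrib-+ (coeff (expand t) w) _ ⟨
    - (coeff (expand t) w + coeff (concatMap expand ts) w)
      ≡⟨ cong -_ (coeff-++ (expand t) _ w) ⟨
    - coeff (expand t ++ concatMap expand ts) w
      ∎
    where open ≡-Reasoning

  InIkron-resp-≈P : ∀ (p q : Poly {N}) → p ≈P q → InIkron q → InIkron p
  InIkron-resp-≈P _ _ p≈q (ts , q≈ts) = ts , λ w → trans (p≈q w) (q≈ts w)

  InIkron-[] : InIkron {N} []
  InIkron-[] = [] , λ _ → refl

  InIkron-−P : ∀ {p q : Poly {N}} → InIkron p → InIkron q → InIkron (p -P q)
  InIkron-−P {p} {q} (ts , p≈P) (us , q≈Q) = ts ++ map negateTerm us , λ w → begin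
    coeff (p -P q) w         ≡⟨ coeff-−P p q w ⟩
    coeff p w - coeff q w    ≡⟨ cong₂ _-_ (p≈P w) (q≈Q w) ⟩
    coeff P w - coeff Q w    ≡⟨ cong (coeff P w +_) (coeff-negateTerms us w) ⟨
    coeff P w + coeff -Q w   ≡⟨ coeff-++ P -Q w ⟨
    coeff (P ++ -Q) w        ≡⟨ cong (λ e → coeff e w) (concatMap-++ expand ts (map negateTerm us)) ⟨
    coeff (concatMap expand (ts ++ map negateTerm us)) w ∎
    where
    open ≡-Reasoning
    P  = concatMap expand ts
    Q  = concatMap expand us
    -Q = concatMap expand (map negateTerm us)

  InIkron-sandwich : ∀ {g : Poly {N}} → KronGen g → ∀ l r → InIkron (sandwich l g r)
  InIkron-sandwich {g} gen l r = term 1ℤ l g gen r ∷ [] , λ w → sym (begin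
    coeff (expand (term 1ℤ l g gen r) ++ []) w
      ≡⟨ cong (λ e → coeff e w) (++-identityʳ (expand (term 1ℤ l g gen r))) ⟩
    coeff (expand (term 1ℤ l g gen r)) w       ≡⟨ coeff-expand 1ℤ l g gen r w ⟩
    1ℤ * coeff (sandwich l g r) w              ≡⟨ ℤₚ.*-identityˡ _ ⟩
    coeff (sandwich l g r) w                   ∎)
    where open ≡-Reasoning

  infix 4 _∼_ _≅_

  _∼_ : Word {N} → Word {N} → Set
  u ∼ v = mono u ≡Ikron mono v

  ∼-refl : ∀ {u} → u ∼ u
  ∼-refl {u} = InIkron-resp-≈P (mono u -P mono u) []
                 (λ w → trans (coeff-−P (mono u) (mono u) w) (ℤₚ.+-inverseʳ (coeff (mono u) w)))
                 InIkron-[]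

  ∼-sym : ∀ {u v} → u ∼ v → v ∼ u
  ∼-sym {u} {v} u∼v = InIkron-resp-≈P (mono v -P mono u) ([] -P (mono u -P mono v)) coeffs
                        (InIkron-−P {p = []} {q = mono u -P mono v} InIkron-[] u∼v)
    where
    identity : ∀ a b → b - a ≡ 0ℤ - (a - b)
    identity = solve-∀
    coeffs : (mono v -P mono u) ≈P ([] -P (mono u -P mono v))
    coeffs w = begin
      coeff (mono v -P mono u) w                 ≡⟨ coeff-−P (mono v) (mono u) w ⟩
      coeff (mono v) w - coeff (mono u) w        ≡⟨ identity (coeff (mono u) w) (coeff (mono v) w) ⟩
      0ℤ - (coeff (mono u) w - coeff (mono v) w) ≡⟨ cong (λ e → 0ℤ - e) (coeff-−P (mono u) (mono v) w) ⟨
      0ℤ - coeff (mono u -P mono v) w            ≡⟨ coeff-−P [] (mono u -P mono v) w ⟨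
      coeff ([] -P (mono u -P mono v)) w         ∎
      where open ≡-Reasoning

  ∼-trans : ∀ {u v t} → u ∼ v → v ∼ t → u ∼ t
  ∼-trans {u} {v} {t} u∼v v∼t =
    InIkron-resp-≈P (mono u -P mono t) ((mono u -P mono v) -P (mono t -P mono v)) coeffs
      (InIkron-−P {p = mono u -P mono v} {q = mono t -P mono v} u∼v (∼-sym {v} {t} v∼t))
    where
    identity : ∀ a b c → a - c ≡ (a - b) - (c - b)
    identity = solve-∀
    coeffs : (mono u -P mono t) ≈P ((mono u -P mono v) -P (mono t -P mono v))
    coeffs w = begin
      coeff (mono u -P mono t) w                                  ≡⟨ coeff-−P (mono u) (mono t) w ⟩
      coeff (mono u) w - coeff (mono t) w
        ≡⟨ identity (coeff (mono u) w) (coeff (mono v) w) (coeff (mono t) w) ⟩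
      (coeff (mono u) w - coeff (mono v) w) - (coeff (mono t) w - coeff (mono v) w)
        ≡⟨ cong₂ _-_ (coeff-−P (mono u) (mono v) w) (coeff-−P (mono t) (mono v) w) ⟨
      coeff (mono u -P mono v) w - coeff (mono t -P mono v) w     ≡⟨ coeff-−P (mono u -P mono v) _ w ⟨
      coeff ((mono u -P mono v) -P (mono t -P mono v)) w          ∎
      where open ≡-Reasoning

  -- The generator (xz − zx)y − y(xz − zx) is, letter for letter, the
  -- difference of the binomials of hypothesis and conclusion.
  ∼-commutator-transfer : ∀ {x y z} → down y ≡ just x → down z ≡ just y → ∀ l r →
    l ++ x ∷ z ∷ y ∷ r ∼ l ++ z ∷ x ∷ y ∷ r → l ++ y ∷ x ∷ z ∷ r ∼ l ++ y ∷ z ∷ x ∷ r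
  ∼-commutator-transfer {x} {y} {z} y⇓ z⇓ l r hyp =
    InIkron-resp-≈P after (before -P (before -P after)) coeffs
      (InIkron-−P {p = before} hyp (InIkron-sandwich (g5 x y z y⇓ z⇓) l r))
    where
    identity : ∀ m n → m ≡ n - (n - m)
    identity = solve-∀
    before after : Poly {N}
    before = mono (l ++ x ∷ z ∷ y ∷ r) -P mono (l ++ z ∷ x ∷ y ∷ r)
    after  = mono (l ++ y ∷ x ∷ z ∷ r) -P mono (l ++ y ∷ z ∷ x ∷ r)
    coeffs : after ≈P (before -P (before -P after))
    coeffs w = begin
      coeff after w
        ≡⟨ identity (coeff after w) (coeff before w) ⟩
      coeff before w - (coeff before w - coeff after w)
        ≡⟨ cong (λ e → coeff before w - e) (coeff-−P before after w) ⟨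
      coeff before w - coeff (before -P after) w
        ≡⟨ coeff-−P before (before -P after) w ⟨
      coeff (before -P (before -P after)) w
        ∎
      where open ≡-Reasoning

  record _≅_ (u v : Word {N}) : Set where
    constructor in-all-contexts
    field in-context : ∀ l r → l ++ u ++ r ∼ l ++ v ++ r
  open _≅_

  ≅-refl : ∀ {u} → u ≅ u
  ≅-refl {u} = in-all-contexts λ l r → ∼-refl {l ++ u ++ r}

  ≅-sym : ∀ {u v} → u ≅ v → v ≅ u
  ≅-sym {u} {v} u≅v = in-all-contexts λ l r →
    ∼-sym {l ++ u ++ r} {l ++ v ++ r} (in-context u≅v l r)

  ≅-trans : ∀ {u v t} → u ≅ v → v ≅ t → u ≅ t
  ≅-trans {u} {v} {t} u≅v v≅t = in-all-contexts λ l r →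
    ∼-trans {l ++ u ++ r} {l ++ v ++ r} {l ++ t ++ r} (in-context u≅v l r) (in-context v≅t l r)

  ≅⇒∼ : ∀ {u v} → u ≅ v → u ∼ v
  ≅⇒∼ {u} {v} u≅v = subst₂ _∼_ (++-identityʳ u) (++-identityʳ v) (in-context u≅v [] [])

  ++-regroup : ∀ (l p m r : Word {N}) → (l ++ p) ++ m ++ r ≡ l ++ (p ++ m) ++ r
  ++-regroup l p m r = trans (++-assoc l p (m ++ r)) (cong (l ++_) (sym (++-assoc p m r)))

  ≅-++ˡ : ∀ p {u v} → u ≅ v → p ++ u ≅ p ++ v
  ≅-++ˡ p {u} {v} u≅v = in-all-contexts λ l r →
    subst₂ _∼_ (++-regroup l p u r) (++-regroup l p v r) (in-context u≅v (l ++ p) r)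

  ≅-++ʳ : ∀ s {u v} → u ≅ v → u ++ s ≅ v ++ s
  ≅-++ʳ s {u} {v} u≅v = in-all-contexts λ l r →
    subst₂ _∼_ (cong (l ++_) (sym (++-assoc u s r))) (cong (l ++_) (sym (++-assoc v s r)))
           (in-context u≅v l (s ++ r))

  generator-≅ : ∀ {u v} → KronGen (binom u v) → u ≅ v
  generator-≅ g = in-all-contexts (InIkron-sandwich g)

  commutator-transfer : ∀ {x y z} → down y ≡ just x → down z ≡ just y → ∀ p s →
    p ++ x ∷ z ∷ y ∷ s ≅ p ++ z ∷ x ∷ y ∷ s → p ++ y ∷ x ∷ z ∷ s ≅ p ++ y ∷ z ∷ x ∷ s
  commutator-transfer {x} {y} {z} y⇓ z⇓ p s hyp = in-all-contexts λ l r →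
    subst₂ _∼_ (++-regroup l p (y ∷ x ∷ z ∷ s) r) (++-regroup l p (y ∷ z ∷ x ∷ s) r)
      (∼-commutator-transfer y⇓ z⇓ (l ++ p) (s ++ r)
        (subst₂ _∼_ (sym (++-regroup l p (x ∷ z ∷ y ∷ s) r)) (sym (++-regroup l p (z ∷ x ∷ y ∷ s) r))
                (in-context hyp l r)))

  rank-injective : ∀ {a b : Letter N} → rank a ≡ rank b → a ≡ b
  rank-injective {⟨ i , false ⟩} {⟨ j , false ⟩} eq =
    cong ⟨_, false ⟩ (Finₚ.toℕ-injective (ℕₚ.*-cancelˡ-≡ _ _ 2 eq))
  rank-injective {⟨ i , false ⟩} {⟨ j , true ⟩}  eq = ⊥-elim (ℕₚ.even≢odd (toℕ i) (toℕ j) eq)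
  rank-injective {⟨ i , true ⟩}  {⟨ j , false ⟩} eq = ⊥-elim (ℕₚ.even≢odd (toℕ j) (toℕ i) (sym eq))
  rank-injective {⟨ i , true ⟩}  {⟨ j , true ⟩}  eq =
    cong ⟨_, true ⟩ (Finₚ.toℕ-injective (ℕₚ.*-cancelˡ-≡ _ _ 2 (ℕₚ.suc-injective eq)))

  down⇒rank : ∀ {a b : Letter N} → down a ≡ just b → rank a ≡ suc (rank b)
  down⇒rank {⟨ i , true ⟩}          refl = refl
  down⇒rank {⟨ Fin.suc i , false ⟩} refl
    rewrite Finₚ.toℕ-inject₁ i = ℕₚ.*-suc 2 (toℕ i)

  down-defined : ∀ (a : Letter N) → 0 < rank a → ∃[ b ] down a ≡ just b
  down-defined ⟨ i , true ⟩                 _ = _ , refl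
  down-defined ⟨ Fin.suc i , false ⟩   _ = _ , refl

  rank⇒down : ∀ {a b : Letter N} → rank a ≡ suc (rank b) → down a ≡ just b
  rank⇒down {a} {b} eq with down-defined a (subst (0 <_) (sym eq) (s≤s z≤n))
  ... | _ , a⇓ =
    trans a⇓ (cong just (rank-injective (ℕₚ.suc-injective (trans (sym (down⇒rank a⇓)) eq))))

  down-unbarred : ∀ {a b : Letter N} → Unbarred a → down a ≡ just b → Barred b
  down-unbarred {⟨ Fin.suc i , false ⟩} _ refl = refl

  down-barred : ∀ {a b : Letter N} → Barred a → down a ≡ just b → Unbarred b
  down-barred {⟨ i , true ⟩} _ refl = refl

  Barred⇒0<rank : ∀ {a : Letter N} → Barred a → 0 < rank a
  Barred⇒0<rank {⟨ i , true ⟩} _ = s≤s z≤n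

  ⪰col⇒≤L : ∀ {y x : Letter N} → y ⪰col x → x ≤L y
  ⪰col⇒≤L (inj₁ x<y)         = ℕₚ.<⇒≤ x<y
  ⪰col⇒≤L (inj₂ (refl , _)) = ℕₚ.≤-refl

  ColChain⇒≤L : ∀ {y : Letter N} {xs} → ColChain y xs → All (_≤L y) xs
  ColChain⇒≤L {xs = []}     _          = []
  ColChain⇒≤L {xs = x ∷ xs} (y⪰x , ch) =
    ⪰col⇒≤L y⪰x ∷ All.map (λ x′≤x → ℕₚ.≤-trans x′≤x (⪰col⇒≤L y⪰x)) (ColChain⇒≤L ch)

  ColChain⇒<L : ∀ {y : Letter N} {xs} → Unbarred y → ColChain y xs → All (_<L y) xs
  ColChain⇒<L {xs = []}     _ _ = []
  ColChain⇒<L {xs = x ∷ xs} _ (inj₁ x<y , ch) =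
    x<y ∷ All.map (λ x′≤x → ℕₚ.≤-<-trans x′≤x x<y) (ColChain⇒≤L ch)
  ColChain⇒<L {xs = x ∷ xs} y-unbarred (inj₂ (refl , y-barred) , _)
    with () ← trans (sym y-barred) y-unbarred

  -- x ≪ z says that z⇓⇓ is defined and x <L z⇓⇓, the side condition of
  -- the commutation generator xz − zx.
  _≪_ : Letter N → Letter N → Set
  x ≪ z = 3 ℕ.+ rank x ≤ rank z

  ≪⇒below-⇓⇓ : ∀ {x z} → x ≪ z → ∃[ w ] ∃[ v ] down z ≡ just w × down w ≡ just v × x <L v
  ≪⇒below-⇓⇓ {x} {z} x≪z with down-defined z (ℕₚ.≤-trans (s≤s z≤n) x≪z)
  ... | w , z⇓ with s≤s⁻¹ (subst (3 ℕ.+ rank x ≤_) (down⇒rank z⇓) x≪z)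
  ...   | x+2≤w with down-defined w (ℕₚ.≤-trans (s≤s z≤n) x+2≤w)
  ...     | v , w⇓ = w , v , z⇓ , w⇓ , s≤s⁻¹ (subst (2 ℕ.+ rank x ≤_) (down⇒rank w⇓) x+2≤w)

  ≪-commute : ∀ {x z} → x ≪ z → x ∷ z ∷ [] ≅ z ∷ x ∷ []
  ≪-commute {x} {z} x≪z with ≪⇒below-⇓⇓ {x} {z} x≪z
  ... | w , v , z⇓ , w⇓ , x<v = generator-≅ (g6 x z w v z⇓ w⇓ x<v)

  ≪-commute-past : ∀ {z xs} → All (_≪ z) xs → xs ++ z ∷ [] ≅ z ∷ xs
  ≪-commute-past []                       = ≅-refl
  ≪-commute-past {xs = x ∷ xs} (x≪z ∷ xs≪z) =
    ≅-trans (≅-++ˡ (x ∷ []) (≪-commute-past xs≪z)) (≅-++ʳ xs (≪-commute x≪z))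

  ColChain-commute-far : ∀ {y z xs} → ColChain y xs → 2 ℕ.+ rank y ≤ rank z →
                         y ∷ xs ++ z ∷ [] ≅ y ∷ z ∷ xs
  ColChain-commute-far {xs = []} _ _ = ≅-refl
  ColChain-commute-far {y} {z} {x ∷ xs} (inj₁ x<y , ch) y+2≤z =
    ≅-++ˡ (y ∷ []) (≪-commute-past (far {x} x<y ∷
      All.map (λ {x′} x′≤x → far {x′} (ℕₚ.≤-<-trans x′≤x x<y)) (ColChain⇒≤L ch)))
    where
    far : ∀ {x′} → x′ <L y → x′ ≪ z
    far x′<y = ℕₚ.≤-trans (s≤s (s≤s x′<y)) y+2≤z
  ColChain-commute-far {y} {z} {.y ∷ xs} (inj₂ (refl , y-barred) , ch) y+2≤z =
    ≅-trans (≅-++ˡ (y ∷ []) (ColChain-commute-far ch y+2≤z))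
            (≅-++ʳ xs (generator-≅ (g3 y z y-barred (ℕₚ.≤-trans (ℕₚ.n≤1+n _) y+2≤z))))

  replicate-++-∷ : ∀ n (x : Letter N) s → replicate n x ++ x ∷ s ≡ x ∷ replicate n x ++ s
  replicate-++-∷ zero    x s = refl
  replicate-++-∷ (suc n) x s = cong (x ∷_) (replicate-++-∷ n x s)

  module UnbarredSquare {y u v : Letter N} (y-unbarred : Unbarred y)
                        (y⇓ : down y ≡ just u) (u⇓ : down u ≡ just v) where

    u-barred : Barred u
    u-barred = down-unbarred y-unbarred y⇓

    v-unbarred : Unbarred v
    v-unbarred = down-barred u-barred u⇓

    rank-y : rank y ≡ suc (suc (rank v))
    rank-y = trans (down⇒rank y⇓) (cong suc (down⇒rank u⇓))

    u<y : u <L y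
    u<y = ℕₚ.≤-reflexive (sym (down⇒rank y⇓))

    v<y : v <L y
    v<y = subst (suc (rank v) ≤_) (sym rank-y) (ℕₚ.n≤1+n _)

    below-v⇒≪y : ∀ {x} → x <L v → x ≪ y
    below-v⇒≪y x<v = subst (3 ℕ.+ _ ≤_) (sym rank-y) (s≤s (s≤s x<v))

    u^ : ℕ → Word {N}
    u^ a = replicate a u

    u-pow-shift : ∀ a s → u ∷ y ∷ u^ a ++ s ≅ u ∷ u^ a ++ y ∷ s
    u-pow-shift zero    s = ≅-refl
    u-pow-shift (suc a) s =
      ≅-trans (≅-++ʳ (u^ a ++ s) (≅-sym (generator-≅ (g3 u y u-barred u<y))))
              (≅-++ˡ (u ∷ []) (u-pow-shift a s))

    y-pow-y : ∀ a s → y ∷ u^ a ++ y ∷ s ≅ y ∷ y ∷ u^ a ++ s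
    y-pow-y zero    s = ≅-refl
    y-pow-y (suc a) s =
      ≅-trans (≅-++ˡ (y ∷ []) (≅-sym (u-pow-shift a s)))
              (≅-++ʳ (u^ a ++ s) (≅-sym (generator-≅ (g1 u y y-unbarred u<y))))

    y-pow-commutator : ∀ a s → y ∷ u^ a ++ v ∷ y ∷ s ≅ y ∷ u^ a ++ y ∷ v ∷ s
    y-pow-commutator zero    s = ≅-++ʳ s (≅-sym (generator-≅ (g1 v y y-unbarred v<y)))
    y-pow-commutator (suc a) s =
      subst₂ _≅_ (cong (y ∷_) (replicate-++-∷ a u (v ∷ y ∷ s)))
                 (cong (y ∷_) (replicate-++-∷ a u (y ∷ v ∷ s)))
        (commutator-transfer u⇓ y⇓ (y ∷ u^ a) s (y-pow-commutator a (u ∷ s)))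

    ColChain-square : ∀ a xs → ColChain u xs → y ∷ u^ a ++ xs ++ y ∷ [] ≅ y ∷ y ∷ u^ a ++ xs
    ColChain-square a []       _ = y-pow-y a []
    ColChain-square a (x ∷ xs) (inj₂ (refl , _) , ch) =
      subst₂ _≅_ (cong (y ∷_) (sym (replicate-++-∷ a u (xs ++ y ∷ []))))
                 (cong (λ t → y ∷ y ∷ t) (sym (replicate-++-∷ a u xs)))
        (ColChain-square (suc a) xs ch)
    ColChain-square a (x ∷ xs) (inj₁ x<u , ch)
      with ℕₚ.m≤n⇒m<n∨m≡n (s≤s⁻¹ (subst (suc (rank x) ≤_) (down⇒rank u⇓) x<u))
    ... | inj₁ x<v =
      ≅-trans (≅-++ˡ (y ∷ u^ a) (≪-commute-past (below-v⇒≪y {x} x<v ∷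
                 All.map (λ {x′} x′≤x → below-v⇒≪y {x′} (ℕₚ.≤-<-trans x′≤x x<v)) (ColChain⇒≤L ch))))
              (y-pow-y a (x ∷ xs))
    ... | inj₂ rank-x≡rank-v with refl ← rank-injective {x} {v} rank-x≡rank-v =
      ≅-trans (≅-++ˡ (y ∷ u^ a) (≅-++ˡ (v ∷ [])
                 (≪-commute-past (All.map (λ {x′} → below-v⇒≪y {x′}) (ColChain⇒<L v-unbarred ch)))))
              (≅-trans (y-pow-commutator a xs) (y-pow-y a (v ∷ xs)))

  ⪰col-⇓ : ∀ {x y u : Letter N} → down y ≡ just u → Barred u → x <L y → u ⪰col x
  ⪰col-⇓ {x} {y} {u} y⇓ u-barred x<y
    with ℕₚ.m≤n⇒m<n∨m≡n (s≤s⁻¹ (subst (suc (rank x) ≤_) (down⇒rank y⇓) x<y))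
  ... | inj₁ x<u  = inj₁ x<u
  ... | inj₂ x≡u  = inj₂ (rank-injective x≡u , u-barred)

  unbarred-square : ∀ {y xs} → Unbarred y → ColChain y xs → y ∷ xs ++ y ∷ [] ≅ y ∷ y ∷ xs
  unbarred-square {xs = []} _ _ = ≅-refl
  unbarred-square {y} {x ∷ xs} y-unbarred ch@(_ , ch′)
    with x<y ∷ _ ← ColChain⇒<L y-unbarred ch
    with u , y⇓ ← down-defined y (ℕₚ.<-≤-trans (s≤s z≤n) x<y)
    with v , u⇓ ← down-defined u (Barred⇒0<rank (down-unbarred y-unbarred y⇓))
    = UnbarredSquare.ColChain-square y-unbarred y⇓ u⇓ 0 (x ∷ xs)
        (⪰col-⇓ y⇓ (down-unbarred y-unbarred y⇓) x<y , ch′)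

lemma6p1 : (N : ℕ) (y z : Letter N) (xs : List (Letter N)) →
    ColChain y xs → y ≤L z →
    ¬ (down z ≡ just y) → ¬ ((y ≡ z) × Barred y × Barred z) →
    mono (y ∷ xs ++ z ∷ []) ≡Ikron mono (y ∷ z ∷ xs)
lemma6p1 N y z xs chain y≤z z⇓≢y not-both-barred with ℕₚ.m≤n⇒m<n∨m≡n y≤z
... | inj₂ rank-y≡rank-z with refl ← rank-injective {N} {y} {z} rank-y≡rank-z with bar y in y-bar
...   | true  = ⊥-elim (not-both-barred (refl , refl , refl))
...   | false = ≅⇒∼ (unbarred-square y-bar chain)
lemma6p1 N y z xs chain y≤z z⇓≢y _ | inj₁ y<z with ℕₚ.m≤n⇒m<n∨m≡n y<z
... | inj₂ y+1≡z = ⊥-elim (z⇓≢y (rank⇒down (sym y+1≡z)))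
... | inj₁ y+1<z = ≅⇒∼ (ColChain-commute-far chain y+1<z)
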